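{- Let $p$ be a prime, $\alpha\ge1$, $q=p^\alpha$, and let $\chi$ be a Dirichlet character modulo $q$ which is induced from a character modulo $p^\beta$, where $\beta\le\alpha$. Let $a,b$ be integers and write $\gcd(a,b,q)=p^\gamma$. If $\gamma<\alpha-\operatorname{val}_p(2)$, assume moreover that $\beta\le\alpha-\gamma$ and $\gamma=\operatorname{val}_p(b)$. Then $$S_\chi(a,b;p^\alpha)=\begin{cases}0,&\gamma=\alpha,\ \chi\ne\mathbf 1,\\ p^\alpha-p^{\alpha-1},&\gamma=\alpha,\ \chi=\mathbf 1,\\ p^\gamma\,\chi(b/p^\gamma)\,S_\chi(ab/p^{2\gamma},1;p^{\alpha-\gamma}),&\gamma<\alpha-\operatorname{val}_p(2),\end{cases}$$ where in the last case $\chi$ is regarded as a character modulo $p^{\alpha-\gamma}$. Finally, if $p=2$ and $\gamma=\alpha-1$, then $S_\chi(a,b;2^\alpha)=0$ if $\chi\ne\mathbf 1$ and $S_\chi(a,b;2^\alpha)=2^{\alpha-1}(-1)^{(a+b)/2^\gamma}$ if $\chi=\mathbf 1$.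
   Context: For a positive integer $k$, integers $a,b$ and a Dirichlet character $\chi$ modulo $k$, the twisted Kloosterman sum is $S_\chi(a,b;k)=\sum_{0\le h<k,\ \gcd(h,k)=1}\chi(h)\exp\big(\frac{2\pi i}{k}(ah+b\overline h)\big)$, where $\overline h$ is an inverse of $h$ modulo $k$. $\mathbf 1$ denotes the trivial (principal) character. -}

module Defs where

open import Level using (_⊔_)
open import Algebra.Bundles using (CommutativeRing)
open import Data.Nat as ℕ using (ℕ; zero; suc)
open import Data.Nat.GCD using (gcd)
open import Data.Integer as ℤ using (ℤ; +_)
open import Data.Integer.Divisibility as ℤD using ()
open import Data.Nat.Divisibility as ℕD using ()
open import Data.List using (List; []; _∷_; foldr; filter; upTo; map)
open import Data.Maybe using (Maybe; just; nothing)
open import Data.Bool using (Bool; true; false; if_then_else_)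
open import Relation.Nullary using (¬_; does)
open import Relation.Binary.PropositionalEquality using (_≡_; _≢_)
open import Data.Product using (Σ; _×_)

val-p-2 : ℕ → ℕ
val-p-2 p = if does (p ℕ.≟ 2) then 1 else 0

-- "val_p(b) = γ": p^γ divides b and p^(γ+1) does not (so b ≠ 0).
ValEq : ℕ → ℤ → ℕ → Set
ValEq p b γ = (p ℕ.^ γ) ℕD.∣ ℤ.∣ b ∣ × ¬ ((p ℕ.^ suc γ) ℕD.∣ ℤ.∣ b ∣)

-- residue of an integer modulo k (convention: modulo 0 gives 0; only k ≥ 1 is used)
_mod_ : ℤ → ℕ → ℕ
x mod zero = 0
x mod suc k = x ℤ.%ℕ suc k

-- the inverse of h modulo k: least h' < k with h h' ≡ 1 (mod k) (0 if none; only used for gcd(h,k)=1)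
isInvOf : ℕ → ℕ → ℕ → Bool
isInvOf zero h h' = false
isInvOf (suc k) h h' = does (((h ℕ.* h') ℕ.% suc k) ℕ.≟ (1 ℕ.% suc k))

first : (ℕ → Bool) → List ℕ → ℕ
first d [] = 0
first d (x ∷ xs) = if d x then x else first d xs

inv : ℕ → ℕ → ℕ
inv h k = first (isInvOf k h) (upTo k)

module _ {c ℓ} (R : CommutativeRing c ℓ) where
  open CommutativeRing R

  infixr 8 _^ᴿ_
  _^ᴿ_ : Carrier → ℕ → Carrier
  x ^ᴿ zero = 1#
  x ^ᴿ suc n = x * (x ^ᴿ n)

  ι : ℕ → Carrier
  ι zero = 0#
  ι (suc n) = 1# + ι n

  NoZeroDivisors : Set (c ⊔ ℓ)
  NoZeroDivisors = ∀ x y → (x * y) ≈ 0# → (x ≈ 0#) Data.Sum.⊎ (y ≈ 0#)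
    where import Data.Sum

  PrimitiveRoot : ℕ → Carrier → Set ℓ
  PrimitiveRoot k ζ = (ζ ^ᴿ k ≈ 1#) × (∀ d → 0 ℕ.< d → d ℕ.< k → ¬ (ζ ^ᴿ d ≈ 1#))

  record IsDirichletCharacter (k : ℕ) (χ : ℤ → Carrier) : Set (c ⊔ ℓ) where
    field
      mult     : ∀ m n → χ (m ℤ.* n) ≈ (χ m * χ n)
      one      : χ (+ 1) ≈ 1#
      periodic : ∀ m n → (+ k) ℤD.∣ (m ℤ.- n) → χ m ≈ χ n
      vanish   : ∀ n → gcd ℤ.∣ n ∣ k ≢ 1 → χ n ≈ 0#

  InducedFrom : ℕ → ℕ → (ℤ → Carrier) → Set (c ⊔ ℓ)
  InducedFrom k m χ = Σ (ℤ → Carrier) λ χ' →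
    IsDirichletCharacter m χ' × (∀ n → gcd ℤ.∣ n ∣ k ≡ 1 → χ n ≈ χ' n)

  IsPrincipal : ℕ → (ℤ → Carrier) → Set ℓ
  IsPrincipal k χ = ∀ n → gcd ℤ.∣ n ∣ k ≡ 1 → χ n ≈ 1#

  sumR : List Carrier → Carrier
  sumR = foldr _+_ 0#

  -- twisted Kloosterman sum S_χ(a,b;k), where ω plays the role of exp(2πi/k)
  S : Carrier → (ℤ → Carrier) → ℤ → ℤ → ℕ → Carrier
  S ω χ a b k = sumR (map term (upTo k))
    where
      term : ℕ → Carrier
      term h = if does (gcd h k ℕ.≟ 1)
               then χ (+ h) * (ω ^ᴿ ((a ℤ.* (+ h) ℤ.+ b ℤ.* (+ inv h k)) mod k))
               else 0#

-- For a unit u modulo K = p^s, h ↦ u h permutes the units modulo K and turns S_χ(x, u; K) into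
-- χ(u) S_χ(x u, 1; K). If a = p^γ a′ and b = p^γ b′, each summand of S_χ(a, b; p^(γ+s)) only
-- depends on h modulo p^s, so this sum is p^γ times S_χ(a′, b′; p^s) taken with the root of unity
-- ζ^(p^γ); combined with the substitution this gives the reduction formula. In the other cases the
-- phase a h + b h⁻¹ is constant on the units: it is 0 when p^α divides a and b, and when p = 2 and
-- γ = α − 1 the units are odd, so the phase is 2^γ (a′ + b′) modulo 2^α while ζ^(2^γ) = −1. The sum
-- is then that constant times Σ_h χ(h), which counts the units for principal χ and otherwise
-- vanishes, because χ(u) Σ_h χ(h) = Σ_h χ(h) and there are no zero divisors.
module Submission where

open import Algebra.Bundles using (CommutativeRing)
open import Data.Bool using (Bool; true; false; T; if_then_else_)
open import Data.Empty using (⊥-elim)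
open import Data.Fin using (Fin; toℕ; fromℕ<)
open import Data.Fin.Permutation using (Permutation; permutation; _⟨$⟩ʳ_)
open import Data.Fin.Properties using (toℕ<n; toℕ-fromℕ<; toℕ-injective)
open import Data.Integer as ℤ using (ℤ; +_; +[1+_]; -[1+_]; ∣_∣)
open import Data.Integer.DivMod using (n%ℕd<d; a≡a%ℕn+[a/ℕn]*n)
import Data.Integer.Divisibility.Signed as ℤS
import Data.Integer.Properties as ℤP
open import Data.Integer.Tactic.RingSolver using (solve-∀)
open import Data.List using (_∷_; map; applyUpTo)
open import Data.List.Membership.Propositional.Properties using (∈-upTo⁺)
open import Data.List.Relation.Unary.Any as Any using (Any; here; there)
open import Data.Nat as ℕ using (ℕ; zero; suc; NonZero)
open import Data.Nat.Coprimality using (Coprime; coprime-Bézout; coprime-divisor; coprime⇒gcd≡1; gcd≡1⇒coprime)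
open import Data.Nat.DivMod using (m≡m%n+[m/n]*n; m%n<n; m<n⇒m%n≡m)
open import Data.Nat.Divisibility
  using (_∣_; divides; ∣-refl; ∣-trans; ∣⇒≤; ∣1⇒≡1; m∣m*n; ∣n⇒∣m*n; m%n≡0⇒n∣m; *-monoʳ-∣)
open import Data.Nat.GCD using (gcd; gcd[m,n]∣m; gcd[m,n]∣n; gcd-greatest; module Bézout)
open import Data.Nat.Primality using (Prime; euclidsLemma; prime⇒irreducible; prime⇒nonTrivial; prime⇒nonZero)
import Data.Nat.Properties as ℕP
open import Data.Product using (Σ-syntax; ∃-syntax; _×_; _,_; proj₁; proj₂)
open import Data.Sum as Sum using (_⊎_; inj₁; inj₂)
open import Function.Base using (_∘_; id; const)
open import Function.Bundles using (_⇔_; mk⇔; Equivalence)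
open import Function.Properties.Equivalence using () renaming (sym to ⇔-sym; trans to ⇔-trans)
open import Level using (0ℓ)
open import Relation.Binary.Bundles using (Setoid)
open import Relation.Binary.PropositionalEquality as ≡ using (_≡_; _≢_)
import Relation.Binary.Reasoning.Setoid as SetoidReasoning
open import Relation.Nullary using (¬_; Dec; does; yes; no; contradiction)

open import Defs

-- Congruences and modular inverses

module ModularArithmetic where

  open import Data.Integer using (_+_; _*_; _-_; -_)
  open ≡ using (refl; sym; trans; cong; cong₂; subst; subst₂; module ≡-Reasoning)

  -- A record rather than a Σ-type, so that x, y and k can be inferred from a congruence.
  infix 4 _≡_[mod_]
  record _≡_[mod_] (x y : ℤ) (k : ℕ) : Set where
    constructor witness
    field
      quotient : ℤ
      equation : x ≡ y + quotient * + k

  module _ {k : ℕ} where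

    ≡[mod]-reflexive : ∀ {x y} → x ≡ y → x ≡ y [mod k ]
    ≡[mod]-reflexive {x} refl = witness (+ 0) (x≡x+0*k x (+ k))
      where
      x≡x+0*k : ∀ x k → x ≡ x + + 0 * k
      x≡x+0*k = solve-∀

    ≡[mod]-refl : ∀ {x} → x ≡ x [mod k ]
    ≡[mod]-refl = ≡[mod]-reflexive refl

    ≡[mod]-sym : ∀ {x y} → x ≡ y [mod k ] → y ≡ x [mod k ]
    ≡[mod]-sym {x} {y} (witness t x≡y+tk) = witness (- t) (begin
      y                         ≡⟨ flip y t (+ k) ⟩
      (y + t * + k) - t * + k   ≡⟨ cong (_- t * + k) x≡y+tk ⟨
      x - t * + k               ≡⟨ cong (λ z → x + z) (ℤP.neg-distribˡ-* t (+ k)) ⟩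
      x + (- t) * + k           ∎)
      where
      flip : ∀ y t k → y ≡ (y + t * k) - t * k
      flip = solve-∀
      open ≡-Reasoning

    ≡[mod]-trans : ∀ {x y z} → x ≡ y [mod k ] → y ≡ z [mod k ] → x ≡ z [mod k ]
    ≡[mod]-trans {z = z} (witness s refl) (witness t refl) = witness (t + s) (collect z t s (+ k))
      where
      collect : ∀ z t s k → (z + t * k) + s * k ≡ z + (t + s) * k
      collect = solve-∀

    ≡[mod]-+ : ∀ {x y x′ y′} → x ≡ y [mod k ] → x′ ≡ y′ [mod k ] → x + x′ ≡ y + y′ [mod k ]
    ≡[mod]-+ {y = y} {y′ = y′} (witness s refl) (witness t refl) = witness (s + t) (collect y y′ s t (+ k))
      where
      collect : ∀ y y′ s t k → (y + s * k) + (y′ + t * k) ≡ (y + y′) + (s + t) * k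
      collect = solve-∀

    ≡[mod]-*ˡ : ∀ c {x y} → x ≡ y [mod k ] → c * x ≡ c * y [mod k ]
    ≡[mod]-*ˡ c {y = y} (witness t refl) = witness (c * t) (distrib c y t (+ k))
      where
      distrib : ∀ c y t k → c * (y + t * k) ≡ c * y + (c * t) * k
      distrib = solve-∀

    ≡[mod]-*ʳ : ∀ c {x y} → x ≡ y [mod k ] → x * c ≡ y * c [mod k ]
    ≡[mod]-*ʳ c {x} {y} x≡y = subst₂ _≡_[mod k ] (ℤP.*-comm c x) (ℤP.*-comm c y) (≡[mod]-*ˡ c x≡y)

  ≡[mod]-setoid : ℕ → Setoid 0ℓ 0ℓ
  ≡[mod]-setoid k = record
    { Carrier       = ℤ
    ; _≈_           = _≡_[mod k ]
    ; isEquivalence = record { refl = ≡[mod]-refl ; sym = ≡[mod]-sym ; trans = ≡[mod]-trans }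
    }

  module ≡[mod]-Reasoning (k : ℕ) = SetoidReasoning (≡[mod]-setoid k)

  ≡[mod]-∣ : ∀ {m k x y} → m ∣ k → x ≡ y [mod k ] → x ≡ y [mod m ]
  ≡[mod]-∣ {m} {y = y} (divides n refl) (witness t refl) = witness (t * + n) (begin
    y + t * + (n ℕ.* m)   ≡⟨ cong (λ z → y + t * z) (ℤP.pos-* n m) ⟩
    y + t * (+ n * + m)   ≡⟨ regroup y t (+ n) (+ m) ⟩
    y + (t * + n) * + m   ∎)
    where
    regroup : ∀ y t n m → y + t * (n * m) ≡ y + (t * n) * m
    regroup = solve-∀
    open ≡-Reasoning

  ≡[mod]-scale : ∀ n {k x y} → x ≡ y [mod k ] → + n * x ≡ + n * y [mod n ℕ.* k ]
  ≡[mod]-scale n {k} {y = y} (witness t refl) = witness t (begin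
    + n * (y + t * + k)         ≡⟨ distrib (+ n) y t (+ k) ⟩
    + n * y + t * (+ n * + k)   ≡⟨ cong (λ z → + n * y + t * z) (ℤP.pos-* n k) ⟨
    + n * y + t * + (n ℕ.* k)   ∎)
    where
    distrib : ∀ n y t k → n * (y + t * k) ≡ n * y + t * (n * k)
    distrib = solve-∀
    open ≡-Reasoning

  ≡[mod]⇒∣∣-∣ : ∀ {k x y} → x ≡ y [mod k ] → k ∣ ∣ x - y ∣
  ≡[mod]⇒∣∣-∣ {k} {y = y} (witness t refl) = divides ∣ t ∣ (begin
    ∣ (y + t * + k) - y ∣   ≡⟨ cong ∣_∣ (cancel y t (+ k)) ⟩
    ∣ t * + k ∣             ≡⟨ ℤP.abs-* t (+ k) ⟩
    ∣ t ∣ ℕ.* k             ∎)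
    where
    cancel : ∀ y t k → (y + t * k) - y ≡ t * k
    cancel = solve-∀
    open ≡-Reasoning

  ∣∣-resp-≡[mod] : ∀ {m k x y} → m ∣ k → x ≡ y [mod k ] → m ∣ ∣ y ∣ → m ∣ ∣ x ∣
  ∣∣-resp-≡[mod] {m} {k} {y = y} m∣k (witness t refl) m∣y =
    ℤS.∣⇒∣ᵤ (ℤS.∣m∣n⇒∣m+n (ℤS.∣ᵤ⇒∣ {+ m} {y} m∣y) (ℤS.∣n⇒∣m*n t (ℤS.∣ᵤ⇒∣ {+ m} {+ k} m∣k)))

  ∣∣⇒≡[mod]0 : ∀ {k} x → k ∣ ∣ x ∣ → x ≡ + 0 [mod k ]
  ∣∣⇒≡[mod]0 {k} x k∣x with ℤS.∣ᵤ⇒∣ {+ k} {x} k∣x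
  ... | ℤS.divides t x≡tk = witness t (trans x≡tk (sym (ℤP.+-identityˡ _)))

  ∣∣⇒≡*ˡ : ∀ {k} x → k ∣ ∣ x ∣ → ∃[ x′ ] x ≡ + k * x′
  ∣∣⇒≡*ˡ {k} x k∣x with ℤS.∣ᵤ⇒∣ {+ k} {x} k∣x
  ... | ℤS.divides t x≡tk = t , trans x≡tk (ℤP.*-comm t (+ k))

  *+-≡[mod] : ∀ {k} j r → + (j ℕ.* k ℕ.+ r) ≡ + r [mod k ]
  *+-≡[mod] {k} j r = witness (+ j) (begin
    + (j ℕ.* k ℕ.+ r)   ≡⟨ ℤP.pos-+ (j ℕ.* k) r ⟩
    + (j ℕ.* k) + + r   ≡⟨ ℤP.+-comm (+ (j ℕ.* k)) (+ r) ⟩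
    + r + + (j ℕ.* k)   ≡⟨ cong (λ z → + r + z) (ℤP.pos-* j k) ⟩
    + r + + j * + k     ∎)
    where open ≡-Reasoning

  *-abs-≡[mod] : ∀ n m → + n * m ≡ + (n ℕ.* ∣ m ∣) [mod n ℕ.* 2 ]
  *-abs-≡[mod] n (+ m)    = ≡[mod]-reflexive (sym (ℤP.pos-* n m))
  *-abs-≡[mod] n -[1+ m ] = witness -[1+ m ] (begin
    + n * -[1+ m ]                             ≡⟨ flip (+ n) (+ suc m) ⟩
    + n * + suc m + -[1+ m ] * (+ n * + 2)     ≡⟨ cong₂ (λ x y → x + -[1+ m ] * y) (ℤP.pos-* n (suc m)) (ℤP.pos-* n 2) ⟨
    + (n ℕ.* suc m) + -[1+ m ] * + (n ℕ.* 2)   ∎)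
    where
    flip : ∀ n m → n * (- m) ≡ n * m + (- m) * (n * + 2)
    flip = solve-∀
    open ≡-Reasoning

  odd-*-≡[mod] : ∀ n a b {h i} → + h ≡ + 1 [mod 2 ] → + i ≡ + 1 [mod 2 ] →
                 (+ n * a) * + h + (+ n * b) * + i ≡ + (n ℕ.* ∣ a + b ∣) [mod n ℕ.* 2 ]
  odd-*-≡[mod] n a b {h} {i} h≡1 i≡1 = begin
    (+ n * a) * + h + (+ n * b) * + i   ≡⟨ factor (+ n) a b (+ h) (+ i) ⟩
    + n * (a * + h + b * + i)           ≈⟨ ≡[mod]-scale n (≡[mod]-+ (≡[mod]-*ˡ a h≡1) (≡[mod]-*ˡ b i≡1)) ⟩
    + n * (a * + 1 + b * + 1)           ≡⟨ cong (λ z → + n * z) (cong₂ _+_ (ℤP.*-identityʳ a) (ℤP.*-identityʳ b)) ⟩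
    + n * (a + b)                       ≈⟨ *-abs-≡[mod] n (a + b) ⟩
    + (n ℕ.* ∣ a + b ∣)                 ∎
    where
    factor : ∀ n a b h i → (n * a) * h + (n * b) * i ≡ n * (a * h + b * i)
    factor = solve-∀
    open ≡[mod]-Reasoning (n ℕ.* 2)

  private
    positive-quotient-impossible : ∀ {k r₁ r₂} n → r₁ ℕ.< k → + r₁ ≢ + r₂ + +[1+ n ] * + k
    positive-quotient-impossible {k} {r₁} {r₂} n r₁<k eq = ℕP.<⇒≱ r₁<k (begin
      k                    ≤⟨ ℕP.m≤m+n k (n ℕ.* k) ⟩
      suc n ℕ.* k          ≤⟨ ℕP.m≤n+m _ r₂ ⟩
      r₂ ℕ.+ suc n ℕ.* k   ≡⟨ ℤP.+-injective r₁≡ ⟨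
      r₁                   ∎)
      where
      r₁≡ : + r₁ ≡ + (r₂ ℕ.+ suc n ℕ.* k)
      r₁≡ = trans eq (trans (cong (λ z → + r₂ + z) (sym (ℤP.pos-* (suc n) k))) (sym (ℤP.pos-+ r₂ _)))
      open ℕP.≤-Reasoning

  remainder-unique : ∀ {k r₁ r₂} → r₁ ℕ.< k → r₂ ℕ.< k → + r₁ ≡ + r₂ [mod k ] → r₁ ≡ r₂
  remainder-unique r₁<k r₂<k (witness (+ zero) eq) = ℤP.+-injective (trans eq (ℤP.+-identityʳ _))
  remainder-unique r₁<k r₂<k (witness +[1+ n ] eq) = ⊥-elim (positive-quotient-impossible n r₁<k eq)
  remainder-unique r₁<k r₂<k r₁≡r₂@(witness -[1+ n ] _) =
    ⊥-elim (positive-quotient-impossible n r₂<k (_≡_[mod_].equation (≡[mod]-sym r₁≡r₂)))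

  mod< : ∀ {k} .{{_ : NonZero k}} x → x mod k ℕ.< k
  mod< {suc k} x = n%ℕd<d x (suc k)

  ≡[mod]-mod : ∀ {k} .{{_ : NonZero k}} x → x ≡ + (x mod k) [mod k ]
  ≡[mod]-mod {suc k} x = witness (x ℤ./ℕ suc k) (a≡a%ℕn+[a/ℕn]*n x (suc k))

  ≡[mod]⇒mod≡ : ∀ {k} .{{_ : NonZero k}} {x y} → x ≡ y [mod k ] → x mod k ≡ y mod k
  ≡[mod]⇒mod≡ {x = x} {y} x≡y = remainder-unique (mod< x) (mod< y)
    (≡[mod]-trans (≡[mod]-sym (≡[mod]-mod x)) (≡[mod]-trans x≡y (≡[mod]-mod y)))

  mod≡⇒≡[mod] : ∀ {k} .{{_ : NonZero k}} {x y} → x mod k ≡ y mod k → x ≡ y [mod k ]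
  mod≡⇒≡[mod] {k} {x} {y} eq =
    ≡[mod]-trans (≡[mod]-mod x) (subst (λ r → + r ≡ y [mod k ]) (sym eq) (≡[mod]-sym (≡[mod]-mod y)))

  %-≡[mod] : ∀ {k} .{{_ : NonZero k}} n → + (n ℕ.% k) ≡ + n [mod k ]
  %-≡[mod] {suc k} n = ≡[mod]-sym (≡[mod]-mod (+ n))

  mod-*-%-≡[mod] : ∀ {k} .{{_ : NonZero k}} u h → + (((u mod k) ℕ.* h) ℕ.% k) ≡ u * + h [mod k ]
  mod-*-%-≡[mod] {k} u h = begin
    + (((u mod k) ℕ.* h) ℕ.% k)   ≈⟨ %-≡[mod] ((u mod k) ℕ.* h) ⟩
    + ((u mod k) ℕ.* h)           ≡⟨ ℤP.pos-* (u mod k) h ⟩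
    + (u mod k) * + h             ≈⟨ ≡[mod]-*ʳ (+ h) (≡[mod]-mod u) ⟨
    u * + h                       ∎
    where open ≡[mod]-Reasoning k

  odd⇒≡1[mod2] : ∀ {h} → ¬ 2 ∣ h → + h ≡ + 1 [mod 2 ]
  odd⇒≡1[mod2] {h} 2∤h with h ℕ.% 2 in h%2 | m%n<n h 2
  ... | 0           | _                    = contradiction (m%n≡0⇒n∣m h 2 h%2) 2∤h
  ... | 1           | _                    = mod≡⇒≡[mod] h%2
  ... | suc (suc _) | ℕ.s<s (ℕ.s<s ())

  bézout-inverse : ∀ {k h} → gcd h k ≡ 1 → ∃[ w ] + h * w ≡ + 1 [mod k ]
  bézout-inverse {k} {h} g with coprime-Bézout (gcd≡1⇒coprime g)
  ... | Bézout.+- x y eq = + x , witness (+ y) (begin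
    + h * + x           ≡⟨ ℤP.*-comm (+ h) (+ x) ⟩
    + x * + h           ≡⟨ ℤP.pos-* x h ⟨
    + (x ℕ.* h)         ≡⟨ cong +_ eq ⟨
    + (1 ℕ.+ y ℕ.* k)   ≡⟨ ℤP.pos-+ 1 (y ℕ.* k) ⟩
    + 1 + + (y ℕ.* k)   ≡⟨ cong (λ z → + 1 + z) (ℤP.pos-* y k) ⟩
    + 1 + + y * + k     ∎)
    where open ≡-Reasoning
  ... | Bézout.-+ x y eq = - + x , witness (- + y) (begin
    + h * - + x                 ≡⟨ rearrange (+ h) (+ x) ⟩
    + 1 - (+ 1 + + x * + h)     ≡⟨ cong (λ z → + 1 - (+ 1 + z)) (ℤP.pos-* x h) ⟨
    + 1 - (+ 1 + + (x ℕ.* h))   ≡⟨ cong (λ z → + 1 - z) (ℤP.pos-+ 1 (x ℕ.* h)) ⟨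
    + 1 - + (1 ℕ.+ x ℕ.* h)     ≡⟨ cong (λ z → + 1 - + z) eq ⟩
    + 1 - + (y ℕ.* k)           ≡⟨ cong (λ z → + 1 - z) (ℤP.pos-* y k) ⟩
    + 1 - + y * + k             ≡⟨ cong (λ z → + 1 + z) (ℤP.neg-distribˡ-* (+ y) (+ k)) ⟩
    + 1 + - + y * + k           ∎)
    where
    rearrange : ∀ h x → h * - x ≡ + 1 - (+ 1 + x * h)
    rearrange = solve-∀
    open ≡-Reasoning

  inverse-unique : ∀ {k} x {v w} → x * v ≡ + 1 [mod k ] → x * w ≡ + 1 [mod k ] → v ≡ w [mod k ]
  inverse-unique {k} x {v} {w} xv≡1 xw≡1 = begin
    v             ≡⟨ ℤP.*-identityʳ v ⟨
    v * + 1       ≈⟨ ≡[mod]-*ˡ v xw≡1 ⟨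
    v * (x * w)   ≡⟨ swap v x w ⟩
    w * (x * v)   ≈⟨ ≡[mod]-*ˡ w xv≡1 ⟩
    w * + 1       ≡⟨ ℤP.*-identityʳ w ⟩
    w             ∎
    where
    swap : ∀ v x w → v * (x * w) ≡ w * (x * v)
    swap = solve-∀
    open ≡[mod]-Reasoning k

  first-satisfies : ∀ (d : ℕ → Bool) {xs} → Any (T ∘ d) xs → T (d (first d xs))
  first-satisfies d {x ∷ xs} any with d x in eq | any
  ... | true  | _          = subst T (sym eq) _
  ... | false | here dx    = ⊥-elim (subst T eq dx)
  ... | false | there any′ = first-satisfies d any′

  inv-inverse : ∀ {k} .{{_ : NonZero k}} {h} → gcd h k ≡ 1 → + h * + inv h k ≡ + 1 [mod k ]
  inv-inverse {suc k} {h} g with bézout-inverse {suc k} {h} g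
  ... | w , hw≡1 = mod≡⇒≡[mod] (subst (λ z → z mod suc k ≡ (+ 1) mod suc k) (ℤP.pos-* h (inv h (suc k)))
    (ℕP.≡ᵇ⇒≡ _ _ (first-satisfies (isInvOf (suc k) h) (Any.map (λ { refl → ℕP.≡⇒≡ᵇ _ _ hv≡1 }) (∈-upTo⁺ (mod< w))))))
    where
    v = w mod suc k
    hv≡1 : (h ℕ.* v) ℕ.% suc k ≡ 1 ℕ.% suc k
    hv≡1 = ≡[mod]⇒mod≡ (subst (_≡ + 1 [mod suc k ]) (sym (ℤP.pos-* h v))
      (≡[mod]-trans (≡[mod]-*ˡ (+ h) (≡[mod]-sym (≡[mod]-mod w))) hw≡1))

  %-inverse : ∀ {k} .{{_ : NonZero k}} {v w h} → + v * + w ≡ + 1 [mod k ] → h ℕ.< k →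
              (v ℕ.* ((w ℕ.* h) ℕ.% k)) ℕ.% k ≡ h
  %-inverse {suc k} {v} {w} {h} vw≡1 h<k = trans (≡[mod]⇒mod≡ vw%h≡h) (m<n⇒m%n≡m h<k)
    where
    open ≡[mod]-Reasoning (suc k)
    vw%h≡h : + (v ℕ.* ((w ℕ.* h) ℕ.% suc k)) ≡ + h [mod suc k ]
    vw%h≡h = begin
      + (v ℕ.* ((w ℕ.* h) ℕ.% suc k))   ≡⟨ ℤP.pos-* v _ ⟩
      + v * + ((w ℕ.* h) ℕ.% suc k)     ≈⟨ ≡[mod]-*ˡ (+ v) (%-≡[mod] (w ℕ.* h)) ⟩
      + v * + (w ℕ.* h)                 ≡⟨ cong (λ z → + v * z) (ℤP.pos-* w h) ⟩
      + v * (+ w * + h)                 ≡⟨ ℤP.*-assoc (+ v) (+ w) (+ h) ⟨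
      (+ v * + w) * + h                 ≈⟨ ≡[mod]-*ʳ (+ h) vw≡1 ⟩
      + 1 * + h                         ≡⟨ ℤP.*-identityˡ (+ h) ⟩
      + h                               ∎

  *-inv-≡[mod] : ∀ {k} .{{_ : NonZero k}} {y u h} → + y ≡ u * + h [mod k ] → gcd y k ≡ 1 → gcd h k ≡ 1 →
                 u * + inv y k ≡ + inv h k [mod k ]
  *-inv-≡[mod] {k} {y} {u} {h} y≡uh gy gh = inverse-unique (+ h) h[uI]≡1 (inv-inverse {k} {h} gh)
    where
    open ≡[mod]-Reasoning k
    rearrange : ∀ h u i → h * (u * i) ≡ (u * h) * i
    rearrange = solve-∀
    h[uI]≡1 : + h * (u * + inv y k) ≡ + 1 [mod k ]
    h[uI]≡1 = begin
      + h * (u * + inv y k)   ≡⟨ rearrange (+ h) u (+ inv y k) ⟩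
      (u * + h) * + inv y k   ≈⟨ ≡[mod]-*ʳ (+ inv y k) y≡uh ⟨
      + y * + inv y k         ≈⟨ inv-inverse {k} {y} gy ⟩
      + 1                     ∎

  inv-≡[mod]-∣ : ∀ {k m} .{{_ : NonZero k}} .{{_ : NonZero m}} {h h′} → m ∣ k → + h ≡ + h′ [mod m ] →
                 gcd h k ≡ 1 → gcd h′ m ≡ 1 → + inv h k ≡ + inv h′ m [mod m ]
  inv-≡[mod]-∣ {k} {m} {h} {h′} m∣k h≡h′ gh gh′ = inverse-unique (+ h′) h′I≡1 (inv-inverse {m} {h′} gh′)
    where
    open ≡[mod]-Reasoning m
    h′I≡1 : + h′ * + inv h k ≡ + 1 [mod m ]
    h′I≡1 = begin
      + h′ * + inv h k   ≈⟨ ≡[mod]-*ʳ (+ inv h k) h≡h′ ⟨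
      + h * + inv h k    ≈⟨ ≡[mod]-∣ m∣k (inv-inverse {k} {h} gh) ⟩
      + 1                ∎

  *-cancel-* : ∀ n .{{_ : NonZero n}} {a b a′ b′ c} →
               a ≡ + n * a′ → b ≡ + n * b′ → a * b ≡ + (n ℕ.* n) * c → a′ * b′ ≡ c
  *-cancel-* n {a′ = a′} {b′} {c} refl refl ab≡nnc =
    ℤP.*-cancelˡ-≡ (+ (n ℕ.* n)) (a′ * b′) c {{ℕP.m*n≢0 n n}} (begin
      + (n ℕ.* n) * (a′ * b′)   ≡⟨ cong (_* (a′ * b′)) (ℤP.pos-* n n) ⟩
      (+ n * + n) * (a′ * b′)   ≡⟨ interchange (+ n) a′ b′ ⟩
      (+ n * a′) * (+ n * b′)   ≡⟨ ab≡nnc ⟩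
      + (n ℕ.* n) * c           ∎)
    where
    interchange : ∀ n a b → (n * n) * (a * b) ≡ (n * a) * (n * b)
    interchange = solve-∀
    open ≡-Reasoning

  *-cancel-+ : ∀ n .{{_ : NonZero n}} {a b a′ b′ m} →
               a ≡ + n * a′ → b ≡ + n * b′ → a + b ≡ + n * m → a′ + b′ ≡ m
  *-cancel-+ n {a′ = a′} {b′} refl refl a+b≡nm =
    ℤP.*-cancelˡ-≡ (+ n) (a′ + b′) _ (trans (ℤP.*-distribˡ-+ (+ n) a′ b′) a+b≡nm)

  gcd-gcd≡⇒∣ : ∀ {m n k d} → gcd (gcd m n) k ≡ d → (d ∣ m) × (d ∣ n)
  gcd-gcd≡⇒∣ {m} {n} {k} refl =
    ∣-trans (gcd[m,n]∣m _ k) (gcd[m,n]∣m m n) , ∣-trans (gcd[m,n]∣m _ k) (gcd[m,n]∣n m n)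

  ^-monoʳ-∣ : ∀ p {m n} → m ℕ.≤ n → p ℕ.^ m ∣ p ℕ.^ n
  ^-monoʳ-∣ p {m} {n} m≤n = divides (p ℕ.^ (n ℕ.∸ m)) (begin
    p ℕ.^ n                       ≡⟨ cong (p ℕ.^_) (ℕP.m+[n∸m]≡n m≤n) ⟨
    p ℕ.^ (m ℕ.+ (n ℕ.∸ m))       ≡⟨ ℕP.^-distribˡ-+-* p m (n ℕ.∸ m) ⟩
    p ℕ.^ m ℕ.* p ℕ.^ (n ℕ.∸ m)   ≡⟨ ℕP.*-comm (p ℕ.^ m) _ ⟩
    p ℕ.^ (n ℕ.∸ m) ℕ.* p ℕ.^ m   ∎)
    where open ≡-Reasoning

  m∣m^n : ∀ m n .{{_ : NonZero n}} → m ∣ m ℕ.^ n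
  m∣m^n m (suc n) = m∣m*n (m ℕ.^ n)

  p^[e∸1]*[p∸1]≡p^e∸p^[e∸1] : ∀ p e .{{_ : NonZero e}} →
                              p ℕ.^ (e ℕ.∸ 1) ℕ.* (p ℕ.∸ 1) ≡ p ℕ.^ e ℕ.∸ p ℕ.^ (e ℕ.∸ 1)
  p^[e∸1]*[p∸1]≡p^e∸p^[e∸1] p (suc e) = trans (ℕP.*-distribˡ-∸ (p ℕ.^ e) p 1)
    (cong₂ ℕ._∸_ (ℕP.*-comm (p ℕ.^ e) p) (ℕP.*-identityʳ (p ℕ.^ e)))

  module _ {p : ℕ} (p-prime : Prime p) where

    coprime-^ : ∀ {h} → ¬ p ∣ h → ∀ e → Coprime h (p ℕ.^ e)
    coprime-^ p∤h zero (_ , i∣1) = ∣1⇒≡1 i∣1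
    coprime-^ {h} p∤h (suc e) {i} (i∣h , i∣p^1+e) with prime⇒irreducible p-prime i∣p
      where
      i∣p : i ∣ p
      i∣p = coprime-divisor (λ (j∣i , j∣p^e) → coprime-^ p∤h e (∣-trans j∣i i∣h , j∣p^e))
                            (subst (i ∣_) (ℕP.*-comm p (p ℕ.^ e)) i∣p^1+e)
    ... | inj₁ i≡1  = i≡1
    ... | inj₂ refl = ⊥-elim (p∤h i∣h)

    p∤1 : ¬ p ∣ 1
    p∤1 p∣1 = ℕ.nonTrivial⇒≢1 {{prime⇒nonTrivial p-prime}} (∣1⇒≡1 p∣1)

    gcd-^≡1⇔∤ : ∀ e .{{_ : NonZero e}} {h} → gcd h (p ℕ.^ e) ≡ 1 ⇔ (¬ p ∣ h)
    gcd-^≡1⇔∤ (suc e) = mk⇔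
      (λ g p∣h → p∤1 (subst (p ∣_) g (gcd-greatest p∣h (m∣m*n (p ℕ.^ e)))))
      (λ p∤h → coprime⇒gcd≡1 (coprime-^ p∤h (suc e)))

    gcd-^≡1⇔∤-≡[mod] : ∀ e .{{_ : NonZero e}} {m h y} → p ∣ m → + h ≡ y [mod m ] →
                        gcd h (p ℕ.^ e) ≡ 1 ⇔ (¬ p ∣ ∣ y ∣)
    gcd-^≡1⇔∤-≡[mod] e p∣m h≡y = mk⇔
      (λ g p∣y → Equivalence.to (gcd-^≡1⇔∤ e) g (∣∣-resp-≡[mod] p∣m h≡y p∣y))
      (λ p∤y → Equivalence.from (gcd-^≡1⇔∤ e) (λ p∣h → p∤y (∣∣-resp-≡[mod] p∣m (≡[mod]-sym h≡y) p∣h)))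

    gcd-^≡1-resp-≡[mod] : ∀ e e′ .{{_ : NonZero e}} .{{_ : NonZero e′}} {m h h′} → p ∣ m →
                           + h ≡ + h′ [mod m ] → gcd h (p ℕ.^ e) ≡ 1 ⇔ gcd h′ (p ℕ.^ e′) ≡ 1
    gcd-^≡1-resp-≡[mod] e e′ p∣m h≡h′ = ⇔-trans (gcd-^≡1⇔∤-≡[mod] e p∣m h≡h′) (⇔-sym (gcd-^≡1⇔∤ e′))

    ∤-*ˡ : ∀ {u} → ¬ p ∣ ∣ u ∣ → ∀ y → (¬ p ∣ ∣ u * y ∣) ⇔ (¬ p ∣ ∣ y ∣)
    ∤-*ˡ {u} p∤u y = mk⇔
      (λ p∤uy p∣y → p∤uy (subst (p ∣_) (sym (ℤP.abs-* u y)) (∣n⇒∣m*n ∣ u ∣ p∣y)))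
      (λ p∤y p∣uy → Sum.[ p∤u , p∤y ] (euclidsLemma ∣ u ∣ ∣ y ∣ p-prime (subst (p ∣_) (ℤP.abs-* u y) p∣uy)))

    p^[1+γ]∤⇒p∤quotient : ∀ γ {b b′} → ¬ p ℕ.^ suc γ ∣ ∣ b ∣ → b ≡ + (p ℕ.^ γ) * b′ → ¬ p ∣ ∣ b′ ∣
    p^[1+γ]∤⇒p∤quotient γ {b′ = b′} p^[1+γ]∤b refl p∣b′ = p^[1+γ]∤b
      (subst₂ _∣_ (ℕP.*-comm (p ℕ.^ γ) p) (sym (ℤP.abs-* (+ (p ℕ.^ γ)) b′)) (*-monoʳ-∣ (p ℕ.^ γ) p∣b′))

    inv-∤ : ∀ e .{{_ : NonZero e}} {h} → gcd h (p ℕ.^ e) ≡ 1 → ¬ p ∣ inv h (p ℕ.^ e)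
    inv-∤ e {h} g p∣I = p∤1 (∣∣-resp-≡[mod] (m∣m^n p e) (≡[mod]-sym (inv-inverse {{ℕP.m^n≢0 p e}} {h} g))
      (subst (p ∣_) (sym (ℤP.abs-* (+ h) (+ _))) (∣n⇒∣m*n h p∣I)))
      where instance _ = prime⇒nonZero p-prime

open ModularArithmetic

-- Finite sums and powers in a commutative ring

module _ {c ℓ} (R : CommutativeRing c ℓ) where

  open CommutativeRing R
  open import Algebra.Properties.CommutativeMonoid.Sum +-commutativeMonoid using (sum-permute)
  open import Algebra.Properties.Monoid.Sum +-monoid using (sum; sum-cong-≋; sum-replicate)
  open import Algebra.Properties.Semiring.Exp semiring using (_^_; ^-homo-*; ^-assocʳ; ^-congˡ)
  open import Algebra.Properties.Semiring.Mult semiring using (×1-homo-*) renaming (_×_ to _×ᵣ_)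
  open import Algebra.Properties.Semiring.Sum semiring using (*-distribˡ-sum)
  open import Relation.Binary.Reasoning.Setoid setoid
  open ≡ using (cong; cong₂)

  ^ᴿ≡^ : ∀ x n → _^ᴿ_ R x n ≡ x ^ n
  ^ᴿ≡^ x zero    = ≡.refl
  ^ᴿ≡^ x (suc n) = cong (x *_) (^ᴿ≡^ x n)

  ι≡×1# : ∀ n → ι R n ≡ n ×ᵣ 1#
  ι≡×1# zero    = ≡.refl
  ι≡×1# (suc n) = cong (λ x → 1# + x) (ι≡×1# n)

  ι-* : ∀ m n → ι R (m ℕ.* n) ≈ ι R m * ι R n
  ι-* m n = begin
    ι R (m ℕ.* n)           ≡⟨ ι≡×1# (m ℕ.* n) ⟩
    (m ℕ.* n) ×ᵣ 1#         ≈⟨ ×1-homo-* m n ⟩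
    (m ×ᵣ 1#) * (n ×ᵣ 1#)   ≡⟨ cong₂ _*_ (ι≡×1# m) (ι≡×1# n) ⟨
    ι R m * ι R n           ∎

  1^n≈1 : ∀ n → 1# ^ n ≈ 1#
  1^n≈1 zero    = refl
  1^n≈1 (suc n) = trans (*-identityˡ _) (1^n≈1 n)

  ^-%-≈ : ∀ {ζ k} .{{_ : NonZero k}} → ζ ^ k ≈ 1# → ∀ n → ζ ^ (n ℕ.% k) ≈ ζ ^ n
  ^-%-≈ {ζ} {k} ζ^k≈1 n = sym (begin
    ζ ^ n                                   ≡⟨ cong (ζ ^_) n≡n%k+k*[n/k] ⟩
    ζ ^ (n ℕ.% k ℕ.+ k ℕ.* (n ℕ./ k))       ≈⟨ ^-homo-* ζ (n ℕ.% k) _ ⟩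
    ζ ^ (n ℕ.% k) * ζ ^ (k ℕ.* (n ℕ./ k))   ≈⟨ *-congˡ (^-assocʳ ζ k (n ℕ./ k)) ⟨
    ζ ^ (n ℕ.% k) * (ζ ^ k) ^ (n ℕ./ k)     ≈⟨ *-congˡ (trans (^-congˡ (n ℕ./ k) ζ^k≈1) (1^n≈1 (n ℕ./ k))) ⟩
    ζ ^ (n ℕ.% k) * 1#                      ≈⟨ *-identityʳ _ ⟩
    ζ ^ (n ℕ.% k)                           ∎)
    where
    n≡n%k+k*[n/k] : n ≡ n ℕ.% k ℕ.+ k ℕ.* (n ℕ./ k)
    n≡n%k+k*[n/k] = ≡.trans (m≡m%n+[m/n]*n n k) (cong (λ m → n ℕ.% k ℕ.+ m) (ℕP.*-comm (n ℕ./ k) k))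

  ^-mod-≈ : ∀ {ζ k} .{{_ : NonZero k}} → ζ ^ k ≈ 1# → ∀ {x n} → x ≡ + n [mod k ] → ζ ^ (x mod k) ≈ ζ ^ n
  ^-mod-≈ {ζ} {suc k} ζ^k≈1 {n = n} x≡n = trans (reflexive (cong (ζ ^_) (≡[mod]⇒mod≡ x≡n))) (^-%-≈ ζ^k≈1 n)

  ^-mod-*-≈ : ∀ {ζ k} N K .{{_ : NonZero k}} .{{_ : NonZero K}} → k ≡ N ℕ.* K → ζ ^ k ≈ 1# →
              ∀ x → ζ ^ ((+ N ℤ.* x) mod k) ≈ (ζ ^ N) ^ (x mod K)
  ^-mod-*-≈ {ζ} {k} N K k≡NK ζ^k≈1 x = begin
    ζ ^ ((+ N ℤ.* x) mod k)   ≈⟨ ^-mod-≈ ζ^k≈1 Nx≡N[x%K] ⟩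
    ζ ^ (N ℕ.* (x mod K))     ≈⟨ ^-assocʳ ζ N (x mod K) ⟨
    (ζ ^ N) ^ (x mod K)       ∎
    where
    Nx≡N[x%K] : + N ℤ.* x ≡ + (N ℕ.* (x mod K)) [mod k ]
    Nx≡N[x%K] = ≡.subst₂ (λ y m → + N ℤ.* x ≡ y [mod m ]) (≡.sym (ℤP.pos-* N (x mod K))) (≡.sym k≡NK)
                         (≡[mod]-scale N (≡[mod]-mod x))

  -- Σ< and ifCoprime are opaque so that unification does not unfold them, which would block the
  -- inference of their arguments.
  opaque
    Σ< : ℕ → (ℕ → Carrier) → Carrier
    Σ< n f = sum {n} (f ∘ toℕ)

    sumR-map-applyUpTo : ∀ n (f : ℕ → Carrier) (g : ℕ → ℕ) → sumR R (map f (applyUpTo g n)) ≡ Σ< n (f ∘ g)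
    sumR-map-applyUpTo zero    f g = ≡.refl
    sumR-map-applyUpTo (suc n) f g = cong (λ x → f (g 0) + x) (sumR-map-applyUpTo n f (g ∘ suc))

    Σ<-cong : ∀ n {f g} → (∀ i → i ℕ.< n → f i ≈ g i) → Σ< n f ≈ Σ< n g
    Σ<-cong n f≈g = sum-cong-≋ (λ i → f≈g (toℕ i) (toℕ<n i))

    Σ<-*ˡ : ∀ n x f → x * Σ< n f ≈ Σ< n (λ i → x * f i)
    Σ<-*ˡ n x f = *-distribˡ-sum {n} x (f ∘ toℕ)

    Σ<-1# : ∀ n → Σ< n (λ _ → 1#) ≈ ι R n
    Σ<-1# n = trans (sum-replicate n) (reflexive (≡.sym (ι≡×1# n)))

    Σ<-0#∷1# : ∀ n {f} → f 0 ≈ 0# → (∀ i → i ℕ.< n → f (suc i) ≈ 1#) → Σ< (suc n) f ≈ ι R n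
    Σ<-0#∷1# n f0≈0 f≈1 = trans (+-cong f0≈0 (trans (Σ<-cong n f≈1) (Σ<-1# n))) (+-identityˡ _)

    Σ<-+ : ∀ m n f → Σ< (m ℕ.+ n) f ≈ Σ< m f + Σ< n (λ i → f (m ℕ.+ i))
    Σ<-+ zero    n f = sym (+-identityˡ _)
    Σ<-+ (suc m) n f = trans (+-congˡ (Σ<-+ m n (f ∘ suc))) (sym (+-assoc _ _ _))

    Σ<-blocks : ∀ N Q {f g} → (∀ j k → j ℕ.< N → k ℕ.< Q → f (j ℕ.* Q ℕ.+ k) ≈ g k) →
                Σ< (N ℕ.* Q) f ≈ ι R N * Σ< Q g
    Σ<-blocks zero    Q f≈g = sym (zeroˡ _)
    Σ<-blocks (suc N) Q {f} {g} f≈g = begin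
      Σ< (Q ℕ.+ N ℕ.* Q) f                        ≈⟨ Σ<-+ Q (N ℕ.* Q) f ⟩
      Σ< Q f + Σ< (N ℕ.* Q) (λ i → f (Q ℕ.+ i))   ≈⟨ +-cong (Σ<-cong Q (λ k → f≈g 0 k ℕ.z<s))
                                                             (Σ<-blocks N Q {λ i → f (Q ℕ.+ i)} shifted) ⟩
      Σ< Q g + ι R N * Σ< Q g                     ≈⟨ +-congʳ (*-identityˡ _) ⟨
      1# * Σ< Q g + ι R N * Σ< Q g                ≈⟨ distribʳ _ _ _ ⟨
      (1# + ι R N) * Σ< Q g                       ∎
      where
      shifted : ∀ j k → j ℕ.< N → k ℕ.< Q → f (Q ℕ.+ (j ℕ.* Q ℕ.+ k)) ≈ g k
      shifted j k j<N k<Q =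
        trans (reflexive (cong f (≡.sym (ℕP.+-assoc Q (j ℕ.* Q) k)))) (f≈g (suc j) k (ℕ.s<s j<N) k<Q)

    Σ<-bijection : ∀ n (σ τ : ℕ → ℕ) → (∀ {i} → i ℕ.< n → σ i ℕ.< n) → (∀ {i} → i ℕ.< n → τ i ℕ.< n) →
                   (∀ {i} → i ℕ.< n → σ (τ i) ≡ i) → (∀ {i} → i ℕ.< n → τ (σ i) ≡ i) →
                   ∀ f → Σ< n (f ∘ σ) ≈ Σ< n f
    Σ<-bijection n σ τ σ< τ< στ τσ f = begin
      Σ< n (f ∘ σ)                ≈⟨ sum-cong-≋ (λ i → reflexive (cong f (≡.sym (toℕ-fromℕ< (σ< (toℕ<n i)))))) ⟩
      sum (f ∘ toℕ ∘ (π ⟨$⟩ʳ_))   ≈⟨ sum-permute (f ∘ toℕ) π ⟨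
      Σ< n f                      ∎
      where
      Endo< : Set
      Endo< = Σ[ φ ∈ (ℕ → ℕ) ] (∀ {i} → i ℕ.< n → φ i ℕ.< n)
      on-Fin : Endo< → Fin n → Fin n
      on-Fin (φ , φ<) i = fromℕ< (φ< (toℕ<n i))
      inverse : ∀ ((φ , φ<) (ψ , ψ<) : Endo<) → (∀ {i} → i ℕ.< n → φ (ψ i) ≡ i) →
                ∀ i → on-Fin (φ , φ<) (on-Fin (ψ , ψ<) i) ≡ i
      inverse (φ , φ<) (ψ , ψ<) φψ i =
        toℕ-injective (≡.trans (toℕ-fromℕ< _) (≡.trans (cong φ (toℕ-fromℕ< _)) (φψ (toℕ<n i))))
      π : Permutation n n
      π = permutation (on-Fin (σ , σ<)) (on-Fin (τ , τ<))
                      (inverse (σ , σ<) (τ , τ<) στ) (inverse (τ , τ<) (σ , σ<) τσ)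

  Σ<-dilate : ∀ k .{{_ : NonZero k}} v → gcd v k ≡ 1 → ∀ f → Σ< k (λ h → f ((v ℕ.* h) ℕ.% k)) ≈ Σ< k f
  Σ<-dilate k v g = Σ<-bijection k (λ h → (v ℕ.* h) ℕ.% k) (λ h → (inv v k ℕ.* h) ℕ.% k)
    (λ _ → m%n<n _ k) (λ _ → m%n<n _ k) (%-inverse {k} {v} vw≡1) (%-inverse {k} {inv v k} wv≡1)
    where
    vw≡1 : + v ℤ.* + inv v k ≡ + 1 [mod k ]
    vw≡1 = inv-inverse {k} {v} g
    wv≡1 : + inv v k ℤ.* + v ≡ + 1 [mod k ]
    wv≡1 = ≡.subst (_≡ + 1 [mod k ]) (ℤP.*-comm (+ v) (+ inv v k)) vw≡1

  opaque
    ifCoprime : ℕ → ℕ → Carrier → Carrier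
    ifCoprime h k x = if does (gcd h k ℕ.≟ 1) then x else 0#

    ifCoprime-unfold : ∀ h k x → ifCoprime h k x ≡ (if does (gcd h k ℕ.≟ 1) then x else 0#)
    ifCoprime-unfold h k x = ≡.refl

    ifCoprime-≡1 : ∀ {h k x} → gcd h k ≡ 1 → ifCoprime h k x ≈ x
    ifCoprime-≡1 {h} {k} {x} g = if-yes (gcd h k ℕ.≟ 1)
      where
      if-yes : (g? : Dec (gcd h k ≡ 1)) → (if does g? then x else 0#) ≈ x
      if-yes (yes _) = refl
      if-yes (no ¬g) = contradiction g ¬g

    ifCoprime-≢1 : ∀ {h k x} → gcd h k ≢ 1 → ifCoprime h k x ≈ 0#
    ifCoprime-≢1 {h} {k} {x} ¬g = if-no (gcd h k ℕ.≟ 1)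
      where
      if-no : (g? : Dec (gcd h k ≡ 1)) → (if does g? then x else 0#) ≈ 0#
      if-no (yes g) = contradiction g ¬g
      if-no (no _)  = refl

  ifCoprime-cong : ∀ {h k h′ k′ x y} → gcd h k ≡ 1 ⇔ gcd h′ k′ ≡ 1 → (gcd h k ≡ 1 → x ≈ y) →
                   ifCoprime h k x ≈ ifCoprime h′ k′ y
  ifCoprime-cong {h} {k} {h′} {k′} {x} {y} h⇔h′ x≈y with gcd h k ℕ.≟ 1
  ... | yes g = trans (ifCoprime-≡1 {h} {k} g)
                      (trans (x≈y g) (sym (ifCoprime-≡1 {h′} {k′} (Equivalence.to h⇔h′ g))))
  ... | no ¬g = trans (ifCoprime-≢1 {h} {k} {x} ¬g)
                      (sym (ifCoprime-≢1 {h′} {k′} {y} (¬g ∘ Equivalence.from h⇔h′)))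

  *-ifCoprime : ∀ z h k x → z * ifCoprime h k x ≈ ifCoprime h k (z * x)
  *-ifCoprime z h k x with gcd h k ℕ.≟ 1
  ... | yes g = trans (*-congˡ (ifCoprime-≡1 {h} {k} g)) (sym (ifCoprime-≡1 {h} {k} g))
  ... | no ¬g = trans (*-congˡ (ifCoprime-≢1 {h} {k} {x} ¬g))
                      (trans (zeroʳ z) (sym (ifCoprime-≢1 {h} {k} {z * x} ¬g)))

  module _ (noZeroDivisors : NoZeroDivisors R) where

    open import Algebra.Properties.Group +-group using (x∙y⁻¹≈ε⇒x≈y; inverseˡ-unique)
    open import Algebra.Properties.Ring ring using ([y-z]x≈yx-zx; x[y-z]≈xy-xz)

    x*y≈y⇒x≈1⊎y≈0 : ∀ {x y} → x * y ≈ y → x ≈ 1# ⊎ y ≈ 0#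
    x*y≈y⇒x≈1⊎y≈0 {x} {y} xy≈y = Sum.map₁ (x∙y⁻¹≈ε⇒x≈y x 1#) (noZeroDivisors (x - 1#) y (begin
      (x - 1#) * y     ≈⟨ [y-z]x≈yx-zx y x 1# ⟩
      x * y - 1# * y   ≈⟨ +-cong xy≈y (-‿cong (*-identityˡ y)) ⟩
      y - y            ≈⟨ -‿inverseʳ y ⟩
      0#               ∎))

    x*x≈1⇒x≈-1⊎x≈1 : ∀ {x} → x * x ≈ 1# → x ≈ - 1# ⊎ x ≈ 1#
    x*x≈1⇒x≈-1⊎x≈1 {x} xx≈1 =
      Sum.map (inverseˡ-unique x 1#) (x∙y⁻¹≈ε⇒x≈y x 1#) (noZeroDivisors (x + 1#) (x - 1#) (begin
      (x + 1#) * (x - 1#)            ≈⟨ x[y-z]≈xy-xz (x + 1#) x 1# ⟩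
      (x + 1#) * x - (x + 1#) * 1#   ≈⟨ +-cong (distribʳ x x 1#) (-‿cong (*-identityʳ _)) ⟩
      (x * x + 1# * x) - (x + 1#)    ≈⟨ +-congʳ (+-cong xx≈1 (*-identityˡ x)) ⟩
      (1# + x) - (x + 1#)            ≈⟨ +-congʳ (+-comm 1# x) ⟩
      (x + 1#) - (x + 1#)            ≈⟨ -‿inverseʳ _ ⟩
      0#                             ∎))

    ^-half≈-1 : ∀ {ζ} n → ζ ^ (n ℕ.+ n) ≈ 1# → ¬ ζ ^ n ≈ 1# → ζ ^ n ≈ - 1#
    ^-half≈-1 {ζ} n ζ^2n≈1 ζ^n≉1 = Sum.[ id , (λ ζ^n≈1 → contradiction ζ^n≈1 ζ^n≉1) ]′
      (x*x≈1⇒x≈-1⊎x≈1 (trans (sym (^-homo-* ζ n n)) ζ^2n≈1))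

  inducedFrom⇒periodic : ∀ {p α β χ} → Prime p → .{{_ : NonZero α}} → InducedFrom R (p ℕ.^ α) (p ℕ.^ β) χ →
                         ∀ {x y} → ¬ p ∣ ∣ x ∣ → ¬ p ∣ ∣ y ∣ → x ≡ y [mod p ℕ.^ β ] → χ x ≈ χ y
  inducedFrom⇒periodic {α = α} {χ = χ} p-prime (χ′ , χ′-character , χ≈χ′) {x} {y} p∤x p∤y x≡y = begin
    χ x    ≈⟨ χ≈χ′ x (Equivalence.from (gcd-^≡1⇔∤ p-prime α) p∤x) ⟩
    χ′ x   ≈⟨ IsDirichletCharacter.periodic χ′-character x y (≡[mod]⇒∣∣-∣ x≡y) ⟩
    χ′ y   ≈⟨ χ≈χ′ y (Equivalence.from (gcd-^≡1⇔∤ p-prime α) p∤y) ⟨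
    χ y    ∎

  -- Twisted Kloosterman sums modulo prime powers

  -- χ is only assumed periodic on units: for β = 0 a character induced modulo p^α still vanishes
  -- on the multiples of p.
  module KloostermanSums {p} (p-prime : Prime p) (β : ℕ) (χ : ℤ → Carrier)
    (χ-* : ∀ m n → χ (m ℤ.* n) ≈ χ m * χ n)
    (χ-periodic : ∀ {x y} → ¬ p ∣ ∣ x ∣ → ¬ p ∣ ∣ y ∣ → x ≡ y [mod p ℕ.^ β ] → χ x ≈ χ y)
    where

    p^≢0 : ∀ e → NonZero (p ℕ.^ e)
    p^≢0 e = ℕP.m^n≢0 p e {{prime⇒nonZero p-prime}}

    phase : ℤ → ℤ → ℕ → ℕ → ℕ
    phase a b k h = (a ℤ.* + h ℤ.+ b ℤ.* + inv h k) mod k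

    kloosterman : Carrier → ℤ → ℤ → ℕ → Carrier
    kloosterman ω a b k = Σ< k (λ h → ifCoprime h k (χ (+ h) * ω ^ phase a b k h))

    χ-sum : ℕ → Carrier
    χ-sum k = Σ< k (λ h → ifCoprime h k (χ (+ h)))

    S≈kloosterman : ∀ ω a b k → S R ω χ a b k ≈ kloosterman ω a b k
    S≈kloosterman ω a b k = trans (reflexive (sumR-map-applyUpTo k _ id)) (Σ<-cong k termwise)
      where
      termwise : ∀ h → h ℕ.< k → (if does (gcd h k ℕ.≟ 1) then χ (+ h) * _^ᴿ_ R ω (phase a b k h) else 0#) ≈
                                  ifCoprime h k (χ (+ h) * ω ^ phase a b k h)
      termwise h _ = trans (reflexive (≡.sym (ifCoprime-unfold h k _)))
                           (ifCoprime-cong (mk⇔ id id) (λ _ → *-congˡ (reflexive (^ᴿ≡^ ω (phase a b k h)))))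

    kloosterman-constant-phase : ∀ ω a b k {E} → (∀ h → gcd h k ≡ 1 → ω ^ phase a b k h ≈ E) →
                                 kloosterman ω a b k ≈ E * χ-sum k
    kloosterman-constant-phase ω a b k {E} phase≈E = begin
      kloosterman ω a b k                        ≈⟨ Σ<-cong k (λ h _ → ifCoprime-cong (mk⇔ id id) (termwise h)) ⟩
      Σ< k (λ h → ifCoprime h k (E * χ (+ h)))   ≈⟨ Σ<-cong k (λ h _ → *-ifCoprime E h k _) ⟨
      Σ< k (λ h → E * ifCoprime h k (χ (+ h)))   ≈⟨ Σ<-*ˡ k E _ ⟨
      E * χ-sum k                                ∎
      where
      termwise : ∀ h → gcd h k ≡ 1 → χ (+ h) * ω ^ phase a b k h ≈ E * χ (+ h)
      termwise h g = trans (*-congˡ (phase≈E h g)) (*-comm _ E)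

    module _ {s} .{{_ : NonZero s}} (β≤s : β ℕ.≤ s) where

      private
        K = p ℕ.^ s
        instance
          K≢0 : NonZero K
          K≢0 = p^≢0 s

      χ-≡[mod] : ∀ {x y} → ¬ p ∣ ∣ x ∣ → x ≡ y [mod K ] → χ x ≈ χ y
      χ-≡[mod] p∤x x≡y =
        χ-periodic p∤x (λ p∣y → p∤x (∣∣-resp-≡[mod] (m∣m^n p s) x≡y p∣y)) (≡[mod]-∣ (^-monoʳ-∣ p β≤s) x≡y)

      module Dilation (u : ℤ) (p∤u : ¬ p ∣ ∣ u ∣) where

        σ : ℕ → ℕ
        σ h = ((u mod K) ℕ.* h) ℕ.% K

        σ≡u* : ∀ h → + σ h ≡ u ℤ.* + h [mod K ]
        σ≡u* = mod-*-%-≡[mod] u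

        σ-coprime : ∀ {h} → gcd (σ h) K ≡ 1 ⇔ gcd h K ≡ 1
        σ-coprime {h} = ⇔-trans (gcd-^≡1⇔∤-≡[mod] p-prime s (m∣m^n p s) (σ≡u* h))
                                (⇔-trans (∤-*ˡ p-prime {u} p∤u (+ h)) (⇔-sym (gcd-^≡1⇔∤ p-prime s)))

        χ-σ : ∀ {h} → gcd h K ≡ 1 → χ (+ σ h) ≈ χ u * χ (+ h)
        χ-σ {h} g = trans (χ-≡[mod] p∤σh (σ≡u* h)) (χ-* u (+ h))
          where p∤σh = Equivalence.to (gcd-^≡1⇔∤ p-prime s) (Equivalence.from σ-coprime g)

        Σ<-σ : ∀ f → Σ< K (f ∘ σ) ≈ Σ< K f
        Σ<-σ = Σ<-dilate K (u mod K) (Equivalence.from (gcd-^≡1⇔∤ p-prime s) p∤u%K)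
          where
          p∤u%K : ¬ p ∣ u mod K
          p∤u%K p∣u%K = p∤u (∣∣-resp-≡[mod] (m∣m^n p s) (≡[mod]-mod u) p∣u%K)

      χ-sum-invariant : ∀ {u} → ¬ p ∣ ∣ u ∣ → χ u * χ-sum K ≈ χ-sum K
      χ-sum-invariant {u} p∤u = begin
        χ u * χ-sum K                                ≈⟨ Σ<-*ˡ K (χ u) _ ⟩
        Σ< K (λ h → χ u * ifCoprime h K (χ (+ h)))   ≈⟨ Σ<-cong K (λ h _ → termwise h) ⟩
        Σ< K (λ h → ifCoprime (σ h) K (χ (+ σ h)))   ≈⟨ Σ<-σ (λ h → ifCoprime h K (χ (+ h))) ⟩
        χ-sum K                                      ∎
        where
        open Dilation u p∤u
        termwise : ∀ h → χ u * ifCoprime h K (χ (+ h)) ≈ ifCoprime (σ h) K (χ (+ σ h))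
        termwise h = trans (*-ifCoprime _ h K _) (ifCoprime-cong (⇔-sym σ-coprime) (λ g → sym (χ-σ g)))

      kloosterman-dilate : ∀ ω x {u} → ¬ p ∣ ∣ u ∣ → kloosterman ω x u K ≈ χ u * kloosterman ω (x ℤ.* u) (+ 1) K
      kloosterman-dilate ω x {u} p∤u = begin
        kloosterman ω x u K                                                    ≈⟨ Σ<-σ _ ⟨
        Σ< K (λ h → ifCoprime (σ h) K (χ (+ σ h) * ω ^ phase x u K (σ h)))     ≈⟨ Σ<-cong K (λ h _ → termwise h) ⟩
        Σ< K (λ h → χ u * ifCoprime h K (χ (+ h) * ω ^ phase xu (+ 1) K h))    ≈⟨ Σ<-*ˡ K (χ u) _ ⟨
        χ u * kloosterman ω xu (+ 1) K                                         ∎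
        where
        open Dilation u p∤u
        xu = x ℤ.* u
        phase-σ : ∀ {h} → gcd h K ≡ 1 → phase x u K (σ h) ≡ phase xu (+ 1) K h
        phase-σ {h} g = ≡[mod]⇒mod≡ (≡[mod]-+ x[σh]≡[xu]h u[σh]⁻¹≡h⁻¹)
          where
          x[σh]≡[xu]h : x ℤ.* + σ h ≡ xu ℤ.* + h [mod K ]
          x[σh]≡[xu]h = ≡[mod]-trans (≡[mod]-*ˡ x (σ≡u* h)) (≡[mod]-reflexive (≡.sym (ℤP.*-assoc x u (+ h))))
          u[σh]⁻¹≡h⁻¹ : u ℤ.* + inv (σ h) K ≡ + 1 ℤ.* + inv h K [mod K ]
          u[σh]⁻¹≡h⁻¹ = ≡[mod]-trans (*-inv-≡[mod] {u = u} (σ≡u* h) (Equivalence.from σ-coprime g) g)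
                                     (≡[mod]-reflexive (≡.sym (ℤP.*-identityˡ _)))
        termwise : ∀ h → ifCoprime (σ h) K (χ (+ σ h) * ω ^ phase x u K (σ h)) ≈
                         χ u * ifCoprime h K (χ (+ h) * ω ^ phase xu (+ 1) K h)
        termwise h = trans (ifCoprime-cong σ-coprime valuewise) (sym (*-ifCoprime (χ u) h K _))
          where
          valuewise : gcd (σ h) K ≡ 1 →
                      χ (+ σ h) * ω ^ phase x u K (σ h) ≈ χ u * (χ (+ h) * ω ^ phase xu (+ 1) K h)
          valuewise g = trans (*-cong (χ-σ g′) (reflexive (cong (ω ^_) (phase-σ g′)))) (*-assoc _ _ _)
            where g′ = Equivalence.to σ-coprime g

      kloosterman-lift : ∀ γ {ζ} → ζ ^ (p ℕ.^ (γ ℕ.+ s)) ≈ 1# → ∀ a b →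
                         kloosterman ζ (+ p ℕ.^ γ ℤ.* a) (+ p ℕ.^ γ ℤ.* b) (p ℕ.^ (γ ℕ.+ s)) ≈
                         ι R (p ℕ.^ γ) * kloosterman (ζ ^ p ℕ.^ γ) a b K
      kloosterman-lift γ {ζ} ζ^q≈1 a b = begin
        kloosterman ζ (+ N ℤ.* a) (+ N ℤ.* b) q   ≡⟨ cong (λ n → Σ< n term-q) q≡NK ⟩
        Σ< (N ℕ.* K) term-q                       ≈⟨ Σ<-blocks N K (λ j k _ _ → termwise j k) ⟩
        ι R N * kloosterman (ζ ^ N) a b K         ∎
        where
        N = p ℕ.^ γ
        q = p ℕ.^ (γ ℕ.+ s)
        instance
          γ+s≢0 : NonZero (γ ℕ.+ s)
          γ+s≢0 = ℕ.>-nonZero (ℕP.<-≤-trans (ℕ.>-nonZero⁻¹ s) (ℕP.m≤n+m s γ))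
          q≢0 : NonZero q
          q≢0 = p^≢0 (γ ℕ.+ s)
        q≡NK : q ≡ N ℕ.* K
        q≡NK = ℕP.^-distribˡ-+-* p γ s
        term-q : ℕ → Carrier
        term-q h = ifCoprime h q (χ (+ h) * ζ ^ phase (+ N ℤ.* a) (+ N ℤ.* b) q h)
        termwise : ∀ j k → term-q (j ℕ.* K ℕ.+ k) ≈ ifCoprime k K (χ (+ k) * (ζ ^ N) ^ phase a b K k)
        termwise j k = ifCoprime-cong h-coprime (λ g → *-cong (χ-≡[mod] (p∤h g) h≡k) (phase-lift g))
          where
          h = j ℕ.* K ℕ.+ k
          h≡k : + h ≡ + k [mod K ]
          h≡k = *+-≡[mod] j k
          h-coprime : gcd h q ≡ 1 ⇔ gcd k K ≡ 1
          h-coprime = gcd-^≡1-resp-≡[mod] p-prime (γ ℕ.+ s) s (m∣m^n p s) h≡k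
          p∤h = Equivalence.to (gcd-^≡1⇔∤ p-prime (γ ℕ.+ s))
          factor : ∀ n a b h i → (n ℤ.* a) ℤ.* h ℤ.+ (n ℤ.* b) ℤ.* i ≡ n ℤ.* (a ℤ.* h ℤ.+ b ℤ.* i)
          factor = solve-∀
          phase-lift : gcd h q ≡ 1 → ζ ^ phase (+ N ℤ.* a) (+ N ℤ.* b) q h ≈ (ζ ^ N) ^ phase a b K k
          phase-lift g = begin
            ζ ^ phase (+ N ℤ.* a) (+ N ℤ.* b) q h               ≡⟨ cong (λ z → ζ ^ (z mod q)) (factor (+ N) a b (+ h) (+ I)) ⟩
            ζ ^ ((+ N ℤ.* (a ℤ.* + h ℤ.+ b ℤ.* + I)) mod q)     ≈⟨ ^-mod-*-≈ N K q≡NK ζ^q≈1 _ ⟩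
            (ζ ^ N) ^ ((a ℤ.* + h ℤ.+ b ℤ.* + I) mod K)         ≡⟨ cong ((ζ ^ N) ^_) (≡[mod]⇒mod≡ ah+bI≡ak+bI′) ⟩
            (ζ ^ N) ^ phase a b K k                             ∎
            where
            I = inv h q
            I≡I′ : + I ≡ + inv k K [mod K ]
            I≡I′ = inv-≡[mod]-∣ (^-monoʳ-∣ p (ℕP.m≤n+m s γ)) h≡k g (Equivalence.to h-coprime g)
            ah+bI≡ak+bI′ : a ℤ.* + h ℤ.+ b ℤ.* + I ≡ a ℤ.* + k ℤ.+ b ℤ.* + inv k K [mod K ]
            ah+bI≡ak+bI′ = ≡[mod]-+ (≡[mod]-*ˡ a h≡k) (≡[mod]-*ˡ b I≡I′)

      kloosterman-reduce : ∀ γ {ζ} → ζ ^ (p ℕ.^ (γ ℕ.+ s)) ≈ 1# → ∀ a {b} → ¬ p ∣ ∣ b ∣ →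
                           kloosterman ζ (+ p ℕ.^ γ ℤ.* a) (+ p ℕ.^ γ ℤ.* b) (p ℕ.^ (γ ℕ.+ s)) ≈
                           (ι R (p ℕ.^ γ) * χ b) * kloosterman (ζ ^ p ℕ.^ γ) (a ℤ.* b) (+ 1) K
      kloosterman-reduce γ ζ^q≈1 a p∤b = trans (kloosterman-lift γ ζ^q≈1 a _)
        (trans (*-congˡ (kloosterman-dilate _ a p∤b)) (sym (*-assoc _ _ _)))

      kloosterman-divisible : ∀ {ζ} → ζ ^ K ≈ 1# → ∀ {a b} → K ∣ ∣ a ∣ → K ∣ ∣ b ∣ → kloosterman ζ a b K ≈ χ-sum K
      kloosterman-divisible {ζ} ζ^K≈1 {a} {b} K∣a K∣b =
        trans (kloosterman-constant-phase ζ a b K (λ h _ → ^-mod-≈ ζ^K≈1 (phase≡0 h))) (*-identityˡ _)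
        where
        phase≡0 : ∀ h → a ℤ.* + h ℤ.+ b ℤ.* + inv h K ≡ + 0 [mod K ]
        phase≡0 h = ≡[mod]-+ (≡[mod]-*ʳ (+ h) (∣∣⇒≡[mod]0 a K∣a))
                             (≡[mod]-*ʳ (+ inv h K) (∣∣⇒≡[mod]0 b K∣b))

      kloosterman-half : NoZeroDivisors R → p ≡ 2 → ∀ {γ} → s ≡ suc γ →
                         ∀ {ζ} → ζ ^ K ≈ 1# → ¬ ζ ^ (p ℕ.^ γ) ≈ 1# → ∀ a b →
                         kloosterman ζ (+ p ℕ.^ γ ℤ.* a) (+ p ℕ.^ γ ℤ.* b) K ≈ (- 1#) ^ ∣ a ℤ.+ b ∣ * χ-sum K
      kloosterman-half noZeroDivisors p≡2 {γ} s≡1+γ {ζ} ζ^K≈1 ζ^P≉1 a b =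
        kloosterman-constant-phase ζ (+ P ℤ.* a) (+ P ℤ.* b) K phase≈
        where
        P = p ℕ.^ γ
        K≡P*2 : K ≡ P ℕ.* 2
        K≡P*2 = ≡.trans (cong (p ℕ.^_) s≡1+γ) (≡.trans (ℕP.*-comm p P) (cong (P ℕ.*_) p≡2))
        ζ^P≈-1 : ζ ^ P ≈ - 1#
        ζ^P≈-1 = ^-half≈-1 noZeroDivisors P (trans (reflexive (cong (ζ ^_) P+P≡K)) ζ^K≈1) ζ^P≉1
          where
          P+P≡K : P ℕ.+ P ≡ K
          P+P≡K = ≡.trans (cong (P ℕ.+_) (≡.sym (ℕP.+-identityʳ P))) (≡.trans (ℕP.*-comm 2 P) (≡.sym K≡P*2))
        odd : ∀ {h} → ¬ p ∣ h → + h ≡ + 1 [mod 2 ]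
        odd {h} p∤h = odd⇒≡1[mod2] (≡.subst (λ n → ¬ n ∣ h) p≡2 p∤h)
        phase≡ : ∀ h → gcd h K ≡ 1 →
                 (+ P ℤ.* a) ℤ.* + h ℤ.+ (+ P ℤ.* b) ℤ.* + inv h K ≡ + (P ℕ.* ∣ a ℤ.+ b ∣) [mod K ]
        phase≡ h g = ≡.subst (λ n → (+ P ℤ.* a) ℤ.* + h ℤ.+ (+ P ℤ.* b) ℤ.* + inv h K ≡ + (P ℕ.* ∣ a ℤ.+ b ∣) [mod n ])
          (≡.sym K≡P*2) (odd-*-≡[mod] P a b (odd p∤h) (odd (inv-∤ p-prime s g)))
          where p∤h = Equivalence.to (gcd-^≡1⇔∤ p-prime s) g
        phase≈ : ∀ h → gcd h K ≡ 1 → ζ ^ phase (+ P ℤ.* a) (+ P ℤ.* b) K h ≈ (- 1#) ^ ∣ a ℤ.+ b ∣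
        phase≈ h g = begin
          ζ ^ phase (+ P ℤ.* a) (+ P ℤ.* b) K h   ≈⟨ ^-mod-≈ ζ^K≈1 (phase≡ h g) ⟩
          ζ ^ (P ℕ.* ∣ a ℤ.+ b ∣)                 ≈⟨ ^-assocʳ ζ P ∣ a ℤ.+ b ∣ ⟨
          (ζ ^ P) ^ ∣ a ℤ.+ b ∣                   ≈⟨ ^-congˡ ∣ a ℤ.+ b ∣ ζ^P≈-1 ⟩
          (- 1#) ^ ∣ a ℤ.+ b ∣                    ∎

      Σ<-coprime : Σ< K (λ h → ifCoprime h K 1#) ≈ ι R (p ℕ.^ (s ℕ.∸ 1) ℕ.* (p ℕ.∸ 1))
      Σ<-coprime = begin
        Σ< K unit                                       ≡⟨ cong (λ n → Σ< n unit) K≡Pp ⟩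
        Σ< (P ℕ.* p) unit                               ≈⟨ Σ<-blocks P p (λ j k _ _ → ifCoprime-cong (coprime-block j k) (λ _ → refl)) ⟩
        ι R P * Σ< p (λ k → ifCoprime k (p ℕ.^ 1) 1#)   ≈⟨ *-congˡ Σ<-p ⟩
        ι R P * ι R (p ℕ.∸ 1)                           ≈⟨ ι-* P (p ℕ.∸ 1) ⟨
        ι R (P ℕ.* (p ℕ.∸ 1))                           ∎
        where
        unit : ℕ → Carrier
        unit h = ifCoprime h K 1#
        P = p ℕ.^ (s ℕ.∸ 1)
        instance
          p≢0 : NonZero p
          p≢0 = prime⇒nonZero p-prime
        K≡Pp : K ≡ P ℕ.* p
        K≡Pp = ≡.trans (cong (p ℕ.^_) (≡.sym (ℕP.suc-pred s))) (ℕP.*-comm p P)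
        coprime-block : ∀ j k → gcd (j ℕ.* p ℕ.+ k) K ≡ 1 ⇔ gcd k (p ℕ.^ 1) ≡ 1
        coprime-block j k = gcd-^≡1-resp-≡[mod] p-prime s 1 ∣-refl (*+-≡[mod] j k)
        p∤1+i : ∀ {i} → i ℕ.< p ℕ.∸ 1 → ¬ p ∣ suc i
        p∤1+i i<p-1 p∣1+i = ℕP.<⇒≱ (ℕP.<-≤-trans (ℕ.s<s i<p-1) (ℕP.≤-reflexive (ℕP.suc-pred p))) (∣⇒≤ p∣1+i)
        Σ<-p : Σ< p (λ k → ifCoprime k (p ℕ.^ 1) 1#) ≈ ι R (p ℕ.∸ 1)
        Σ<-p = trans (reflexive (cong (λ n → Σ< n (λ k → ifCoprime k (p ℕ.^ 1) 1#)) (≡.sym (ℕP.suc-pred p))))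
          (Σ<-0#∷1# (p ℕ.∸ 1)
            (ifCoprime-≢1 {0} {p ℕ.^ 1} (λ g → Equivalence.to (gcd-^≡1⇔∤ p-prime 1) g (divides 0 ≡.refl)))
            (λ i i<p-1 → ifCoprime-≡1 {suc i} {p ℕ.^ 1} (Equivalence.from (gcd-^≡1⇔∤ p-prime 1) (p∤1+i i<p-1))))

      χ-sum-principal : IsPrincipal R K χ → χ-sum K ≈ ι R (p ℕ.^ (s ℕ.∸ 1) ℕ.* (p ℕ.∸ 1))
      χ-sum-principal χ≈1 = trans (Σ<-cong K (λ h _ → ifCoprime-cong (mk⇔ id id) (χ≈1 (+ h)))) Σ<-coprime

      module _ (noZeroDivisors : NoZeroDivisors R) where

        -- Principality is not decidable, so instead of extracting a unit u with χ(u) ≠ 1 we show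
        -- that the sum vanishes unless χ is 1 on every unit below n.
        χ-sum≈0⊎χ≈1-below : ∀ n → χ-sum K ≈ 0# ⊎ (∀ u → u ℕ.< n → gcd u K ≡ 1 → χ (+ u) ≈ 1#)
        χ-sum≈0⊎χ≈1-below zero    = inj₂ λ _ ()
        χ-sum≈0⊎χ≈1-below (suc n) =
          Sum.[ inj₁ , (λ χ≈1 → Sum.map₂ (extend χ≈1) χ-sum≈0⊎χn≈1) ]′ (χ-sum≈0⊎χ≈1-below n)
          where
          χ-sum≈0⊎χn≈1 : χ-sum K ≈ 0# ⊎ (gcd n K ≡ 1 → χ (+ n) ≈ 1#)
          χ-sum≈0⊎χn≈1 with gcd n K ℕ.≟ 1
          ... | yes g = Sum.swap (Sum.map₁ const (x*y≈y⇒x≈1⊎y≈0 noZeroDivisors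
                          (χ-sum-invariant (Equivalence.to (gcd-^≡1⇔∤ p-prime s) g))))
          ... | no ¬g = inj₂ (λ g → contradiction g ¬g)
          extend : (∀ u → u ℕ.< n → gcd u K ≡ 1 → χ (+ u) ≈ 1#) → (gcd n K ≡ 1 → χ (+ n) ≈ 1#) →
                   ∀ u → u ℕ.< suc n → gcd u K ≡ 1 → χ (+ u) ≈ 1#
          extend χ<n≈1 χn≈1 u u<1+n with ℕP.m<1+n⇒m<n∨m≡n u<1+n
          ... | inj₁ u<n    = χ<n≈1 u u<n
          ... | inj₂ ≡.refl = χn≈1

        χ-sum-nonprincipal : ¬ IsPrincipal R K χ → χ-sum K ≈ 0#
        χ-sum-nonprincipal ¬principal =
          Sum.[ id , (λ χ≈1 → contradiction (principal χ≈1) ¬principal) ]′ (χ-sum≈0⊎χ≈1-below K)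
          where
          principal : (∀ u → u ℕ.< K → gcd u K ≡ 1 → χ (+ u) ≈ 1#) → IsPrincipal R K χ
          principal χ≈1 n g = trans (χ-≡[mod] p∤n (≡[mod]-mod n))
                                    (χ≈1 (n mod K) (mod< n) (Equivalence.from (gcd-^≡1⇔∤ p-prime s) p∤n%K))
            where
            p∤n = Equivalence.to (gcd-^≡1⇔∤ p-prime s) g
            p∤n%K : ¬ p ∣ n mod K
            p∤n%K p∣n%K = p∤n (∣∣-resp-≡[mod] (m∣m^n p s) (≡[mod]-mod n) p∣n%K)

module KloostermanPrimePower {c ℓ} (R : CommutativeRing c ℓ) (noZeroDivisors : NoZeroDivisors R)
  {p α β} (p-prime : Prime p) .{{_ : NonZero α}} (β≤α : β ℕ.≤ α)
  {ζ} (ζ-primitive : PrimitiveRoot R (p ℕ.^ α) ζ)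
  {χ} (χ-character : IsDirichletCharacter R (p ℕ.^ α) χ) (χ-induced : InducedFrom R (p ℕ.^ α) (p ℕ.^ β) χ)
  {a b γ} (gcd≡p^γ : gcd (gcd ∣ a ∣ ∣ b ∣) (p ℕ.^ α) ≡ p ℕ.^ γ)
  where

  open CommutativeRing R
  open import Algebra.Properties.Semiring.Exp semiring using (_^_)
  open import Relation.Binary.Reasoning.Setoid setoid
  open KloostermanSums R p-prime β χ (IsDirichletCharacter.mult χ-character)
                       (inducedFrom⇒periodic R {β = β} p-prime χ-induced)

  private
    q = p ℕ.^ α
    N = p ℕ.^ γ
    instance
      N≢0 : NonZero N
      N≢0 = p^≢0 γ
    N∣a×N∣b : (N ∣ ∣ a ∣) × (N ∣ ∣ b ∣)
    N∣a×N∣b = gcd-gcd≡⇒∣ {∣ a ∣} {∣ b ∣} {q} gcd≡p^γ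

  ζ^q≈1 : ζ ^ q ≈ 1#
  ζ^q≈1 = trans (reflexive (≡.sym (^ᴿ≡^ R ζ q))) (proj₁ ζ-primitive)

  a₀ b₀ : ℤ
  a₀ = proj₁ (∣∣⇒≡*ˡ a (proj₁ N∣a×N∣b))
  b₀ = proj₁ (∣∣⇒≡*ˡ b (proj₂ N∣a×N∣b))

  a≡Na₀ : a ≡ + N ℤ.* a₀
  a≡Na₀ = proj₂ (∣∣⇒≡*ˡ a (proj₁ N∣a×N∣b))

  b≡Nb₀ : b ≡ + N ℤ.* b₀
  b≡Nb₀ = proj₂ (∣∣⇒≡*ˡ b (proj₂ N∣a×N∣b))

  S-divisible : γ ≡ α → S R ζ χ a b q ≈ χ-sum q
  S-divisible γ≡α = trans (S≈kloosterman ζ a b q)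
    (kloosterman-divisible β≤α ζ^q≈1 {a} {b} (q∣ (proj₁ N∣a×N∣b)) (q∣ (proj₂ N∣a×N∣b)))
    where
    q∣ : ∀ {n} → N ∣ n → q ∣ n
    q∣ {n} = ≡.subst (λ e → p ℕ.^ e ∣ n) γ≡α

  S-divisible-nonprincipal : γ ≡ α → ¬ IsPrincipal R q χ → S R ζ χ a b q ≈ 0#
  S-divisible-nonprincipal γ≡α ¬principal =
    trans (S-divisible γ≡α) (χ-sum-nonprincipal β≤α noZeroDivisors ¬principal)

  S-divisible-principal : γ ≡ α → IsPrincipal R q χ → S R ζ χ a b q ≈ ι R (q ℕ.∸ p ℕ.^ (α ℕ.∸ 1))
  S-divisible-principal γ≡α principal = begin
    S R ζ χ a b q                              ≈⟨ S-divisible γ≡α ⟩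
    χ-sum q                                    ≈⟨ χ-sum-principal β≤α principal ⟩
    ι R (p ℕ.^ (α ℕ.∸ 1) ℕ.* (p ℕ.∸ 1))        ≡⟨ ≡.cong (ι R) (p^[e∸1]*[p∸1]≡p^e∸p^[e∸1] p α) ⟩
    ι R (q ℕ.∸ p ℕ.^ (α ℕ.∸ 1))                ∎

  S-reduce : γ ℕ.< α → β ℕ.≤ α ℕ.∸ γ → ValEq p b γ →
             ∀ b′ c′ → b ≡ + N ℤ.* b′ → a ℤ.* b ≡ + p ℕ.^ (γ ℕ.+ γ) ℤ.* c′ →
             S R ζ χ a b q ≈ (ι R N * χ b′) * S R (_^ᴿ_ R ζ N) χ c′ (+ 1) (p ℕ.^ (α ℕ.∸ γ))
  S-reduce γ<α β≤α∸γ (_ , p^[1+γ]∤b) b′ c′ b≡Nb′ ab≡c′ = begin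
    S R ζ χ a b q                                             ≈⟨ S≈kloosterman ζ a b q ⟩
    kloosterman ζ a b (p ℕ.^ α)                               ≡⟨ ≡.cong₂ (λ x e → kloosterman ζ x b (p ℕ.^ e))
                                                                         (≡.sym a≡Na₀) γ+[α∸γ]≡α ⟨
    kloosterman ζ (+ N ℤ.* a₀) b (p ℕ.^ (γ ℕ.+ (α ℕ.∸ γ)))   ≡⟨ ≡.cong (λ y → kloosterman ζ (+ N ℤ.* a₀) y (p ℕ.^ (γ ℕ.+ (α ℕ.∸ γ))))
                                                                        b≡Nb′ ⟩
    kloosterman ζ (+ N ℤ.* a₀) (+ N ℤ.* b′) (p ℕ.^ (γ ℕ.+ (α ℕ.∸ γ)))
                                                              ≈⟨ kloosterman-reduce {{α∸γ≢0}} β≤α∸γ γ ζ^p^[γ+s]≈1 a₀ p∤b′ ⟩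
    (ι R N * χ b′) * kloosterman (ζ ^ N) (a₀ ℤ.* b′) (+ 1) K  ≈⟨ *-congˡ (S≈kloosterman (ζ ^ N) (a₀ ℤ.* b′) (+ 1) K) ⟨
    (ι R N * χ b′) * S R (ζ ^ N) χ (a₀ ℤ.* b′) (+ 1) K        ≡⟨ ≡.cong₂ (λ ω c → (ι R N * χ b′) * S R ω χ c (+ 1) K)
                                                                         (^ᴿ≡^ R ζ N) (≡.sym a₀b′≡c′) ⟨
    (ι R N * χ b′) * S R (_^ᴿ_ R ζ N) χ c′ (+ 1) K            ∎
    where
    K = p ℕ.^ (α ℕ.∸ γ)
    γ+[α∸γ]≡α : γ ℕ.+ (α ℕ.∸ γ) ≡ α
    γ+[α∸γ]≡α = ℕP.m+[n∸m]≡n (ℕP.<⇒≤ γ<α)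
    α∸γ≢0 : NonZero (α ℕ.∸ γ)
    α∸γ≢0 = ℕ.>-nonZero (ℕP.m<n⇒0<n∸m γ<α)
    ζ^p^[γ+s]≈1 : ζ ^ p ℕ.^ (γ ℕ.+ (α ℕ.∸ γ)) ≈ 1#
    ζ^p^[γ+s]≈1 = ≡.subst (λ e → ζ ^ p ℕ.^ e ≈ 1#) (≡.sym γ+[α∸γ]≡α) ζ^q≈1
    p∤b′ = p^[1+γ]∤⇒p∤quotient p-prime γ p^[1+γ]∤b b≡Nb′
    a₀b′≡c′ : a₀ ℤ.* b′ ≡ c′
    a₀b′≡c′ = *-cancel-* N a≡Na₀ b≡Nb′ (≡.trans ab≡c′ (≡.cong (λ n → + n ℤ.* c′) (ℕP.^-distribˡ-+-* p γ γ)))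

  S-half : p ≡ 2 → suc γ ≡ α → S R ζ χ a b q ≈ _^ᴿ_ R (- 1#) ∣ a₀ ℤ.+ b₀ ∣ * χ-sum q
  S-half p≡2 1+γ≡α = begin
    S R ζ χ a b q                                ≈⟨ S≈kloosterman ζ a b q ⟩
    kloosterman ζ a b q                          ≡⟨ ≡.cong₂ (λ x y → kloosterman ζ x y q) a≡Na₀ b≡Nb₀ ⟩
    kloosterman ζ (+ N ℤ.* a₀) (+ N ℤ.* b₀) q    ≈⟨ kloosterman-half β≤α noZeroDivisors p≡2 (≡.sym 1+γ≡α) ζ^q≈1 ζ^N≉1 a₀ b₀ ⟩
    (- 1#) ^ ∣ a₀ ℤ.+ b₀ ∣ * χ-sum q              ≡⟨ ≡.cong (_* χ-sum q) (^ᴿ≡^ R (- 1#) ∣ a₀ ℤ.+ b₀ ∣) ⟨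
    _^ᴿ_ R (- 1#) ∣ a₀ ℤ.+ b₀ ∣ * χ-sum q         ∎
    where
    N<q : N ℕ.< q
    N<q = ≡.subst (λ e → N ℕ.< p ℕ.^ e) 1+γ≡α
            (ℕP.^-monoʳ-< p (ℕ.nonTrivial⇒n>1 p {{prime⇒nonTrivial p-prime}}) (ℕP.n<1+n γ))
    ζ^N≉1 : ¬ ζ ^ N ≈ 1#
    ζ^N≉1 ζ^N≈1 = proj₂ ζ-primitive N (ℕ.>-nonZero⁻¹ N) N<q (trans (reflexive (^ᴿ≡^ R ζ N)) ζ^N≈1)

  S-half-nonprincipal : p ≡ 2 → suc γ ≡ α → ¬ IsPrincipal R q χ → S R ζ χ a b q ≈ 0#
  S-half-nonprincipal p≡2 1+γ≡α ¬principal =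
    trans (S-half p≡2 1+γ≡α) (trans (*-congˡ (χ-sum-nonprincipal β≤α noZeroDivisors ¬principal)) (zeroʳ _))

  S-half-principal : p ≡ 2 → suc γ ≡ α → IsPrincipal R q χ → ∀ m → a ℤ.+ b ≡ + (2 ℕ.^ γ) ℤ.* m →
                     S R ζ χ a b q ≈ ι R (2 ℕ.^ (α ℕ.∸ 1)) * _^ᴿ_ R (- 1#) ∣ m ∣
  S-half-principal p≡2 1+γ≡α principal m a+b≡2^γm = begin
    S R ζ χ a b q                                              ≈⟨ S-half p≡2 1+γ≡α ⟩
    _^ᴿ_ R (- 1#) ∣ a₀ ℤ.+ b₀ ∣ * χ-sum q                       ≈⟨ *-cong (reflexive (≡.cong (λ n → _^ᴿ_ R (- 1#) ∣ n ∣) a₀+b₀≡m))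
                                                                          (χ-sum-principal β≤α principal) ⟩
    _^ᴿ_ R (- 1#) ∣ m ∣ * ι R (p ℕ.^ (α ℕ.∸ 1) ℕ.* (p ℕ.∸ 1))   ≈⟨ *-comm _ _ ⟩
    ι R (p ℕ.^ (α ℕ.∸ 1) ℕ.* (p ℕ.∸ 1)) * _^ᴿ_ R (- 1#) ∣ m ∣   ≡⟨ ≡.cong (λ n → ι R n * _^ᴿ_ R (- 1#) ∣ m ∣) totient≡2^[α∸1] ⟩
    ι R (2 ℕ.^ (α ℕ.∸ 1)) * _^ᴿ_ R (- 1#) ∣ m ∣                 ∎
    where
    a₀+b₀≡m : a₀ ℤ.+ b₀ ≡ m
    a₀+b₀≡m = *-cancel-+ N a≡Na₀ b≡Nb₀ (≡.subst (λ n → a ℤ.+ b ≡ + (n ℕ.^ γ) ℤ.* m) (≡.sym p≡2) a+b≡2^γm)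
    totient≡2^[α∸1] : p ℕ.^ (α ℕ.∸ 1) ℕ.* (p ℕ.∸ 1) ≡ 2 ℕ.^ (α ℕ.∸ 1)
    totient≡2^[α∸1] = ≡.trans (≡.cong (λ n → n ℕ.^ (α ℕ.∸ 1) ℕ.* (n ℕ.∸ 1)) p≡2) (ℕP.*-identityʳ _)

open import Data.Nat using (_≤_; _<_; _∸_; _^_)

proposition3p3 : ∀ {c ℓ} (R : CommutativeRing c ℓ) → NoZeroDivisors R →
  (p α β : ℕ) → Prime p → 1 ≤ α → β ≤ α →
  (ζ : CommutativeRing.Carrier R) → PrimitiveRoot R (p ^ α) ζ →
  (χ : ℤ → CommutativeRing.Carrier R) →
  IsDirichletCharacter R (p ^ α) χ → InducedFrom R (p ^ α) (p ^ β) χ →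
  (a b : ℤ) (γ : ℕ) → gcd (gcd ∣ a ∣ ∣ b ∣) (p ^ α) ≡ p ^ γ →
  let open CommutativeRing R
      q = p ^ α
  in ((γ ≡ α → ¬ IsPrincipal R q χ → S R ζ χ a b q ≈ 0#)
     × (γ ≡ α → IsPrincipal R q χ → S R ζ χ a b q ≈ ι R (q ∸ p ^ (α ∸ 1)))
     × (γ < α ∸ val-p-2 p → β ≤ α ∸ γ → ValEq p b γ →
          (b′ c′ : ℤ) → b ≡ (+ (p ^ γ)) ℤ.* b′ → a ℤ.* b ≡ (+ (p ^ (γ Data.Nat.+ γ))) ℤ.* c′ →
          S R ζ χ a b q ≈ ((ι R (p ^ γ) * χ b′) * S R (_^ᴿ_ R ζ (p ^ γ)) χ c′ (+ 1) (p ^ (α ∸ γ))))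
     × (p ≡ 2 → suc γ ≡ α →
          (¬ IsPrincipal R q χ → S R ζ χ a b q ≈ 0#)
          × (IsPrincipal R q χ → (m : ℤ) → a ℤ.+ b ≡ (+ (2 ^ γ)) ℤ.* m →
               S R ζ χ a b q ≈ (ι R (2 ^ (α ∸ 1)) * _^ᴿ_ R (- 1#) ∣ m ∣))))
proposition3p3 R noZeroDivisors p α β p-prime 1≤α β≤α ζ ζ-primitive χ χ-character χ-induced a b γ gcd≡p^γ =
    S-divisible-nonprincipal
  , S-divisible-principal
  , (λ γ<α∸v₂ → S-reduce (ℕP.<-≤-trans γ<α∸v₂ (ℕP.m∸n≤m α (val-p-2 p))))
  , (λ p≡2 1+γ≡α → S-half-nonprincipal p≡2 1+γ≡α , S-half-principal p≡2 1+γ≡α)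
  where
  instance
    α≢0 : ℕ.NonZero α
    α≢0 = ℕ.>-nonZero 1≤α
  open KloostermanPrimePower R noZeroDivisors p-prime β≤α ζ-primitive χ-character χ-induced {a} {b} {γ} gcd≡p^γ
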